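{- For all integers $n,r\ge 0$ and $j\ge 1$, $$p^{r+1}_j(n)=2\,p^r_j(n)-p^r_{j-1}(n).$$
   Context: A preferential arrangement of a finite set $S$ is an ordered set partition of $S$ (a sequence of nonempty pairwise disjoint blocks with union $S$); the empty set has exactly one. Let $a(w)$ be the number of preferential arrangements of a $w$-element set ($a(0)=1$). A barred preferential arrangement of $X_n=\{1,\dots,n\}$ with $k$ bars is a sequence of $k+1$ possibly empty, pairwise disjoint sections with union $X_n$, each equipped with a preferential arrangement of its elements. A restricted section is one whose preferential arrangement has at most one block (exactly one choice); a free section may carry any preferential arrangement. For integers $r,j\ge0$, $p^r_j(n)$ is the number of barred preferential arrangements of $X_n$ with $r+j$ sections ($r+j-1$ bars) in which $r$ fixed sections are restricted and $j$ fixed sections are free; equivalently $p^r_j(n)=\sum_{w_1+\cdots+w_{r+j}=n}\frac{n!}{w_1!\cdots w_{r+j}!}\prod_{i=r+1}^{r+j}a(w_i)$ (sum over nonnegative integer solutions; for $r=j=0$ this is the empty-sum/empty-product convention giving $1$ if $n=0$ and $0$ otherwise). In particular $p^r_0(n)=r^n$ with $0^0=1$. -}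

module Defs where

open import Data.Nat using (ℕ; zero; suc; _+_; _*_; _∸_)
open import Data.Nat.Combinatorics using (_C_)
open import Data.List using (List; []; _∷_; map; concatMap; applyUpTo)
open import Data.Nat.ListAction using (sum; product)

multinomial : List ℕ → ℕ
multinomial []       = 1
multinomial (w ∷ ws) = ((w + sum ws) C w) * multinomial ws

weakCompositions : ℕ → ℕ → List (List ℕ)
weakCompositions zero    zero    = [] ∷ []
weakCompositions zero    (suc n) = []
weakCompositions (suc m) n       =
  concatMap (λ w → map (w ∷_) (weakCompositions m (n ∸ w))) (applyUpTo (λ i → i) (suc n))

compositions : ℕ → List (List ℕ)
compositions n = concatMap (λ m → filterPos m) (applyUpTo (λ i → i) (suc n))
  where
  allPos : List ℕ → ℕ
  allPos []            = 1
  allPos (zero ∷ _)    = 0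
  allPos (suc _ ∷ ws)  = allPos ws
  keep : List (List ℕ) → List (List ℕ)
  keep [] = []
  keep (ws ∷ wss) with allPos ws
  ... | zero  = keep wss
  ... | suc _ = ws ∷ keep wss
  filterPos : ℕ → List (List ℕ)
  filterPos m = keep (weakCompositions m n)

-- a(w): number of preferential arrangements (ordered set partitions) of a
-- w-element set: sum over the sequence of block sizes (a composition of w)
-- of the number of ways to fill the blocks, i.e. the multinomial coefficient.
a : ℕ → ℕ
a w = sum (map multinomial (compositions w))

p : ℕ → ℕ → ℕ → ℕ
p r j n = sum (map term (weakCompositions (r + j) n))
  where
  drop' : ℕ → List ℕ → List ℕ
  drop' zero    ws       = ws
  drop' (suc k) []       = []
  drop' (suc k) (_ ∷ ws) = drop' k ws
  term : List ℕ → ℕ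
  term ws = multinomial ws * product (map a (drop' r ws))

{-# OPTIONS --safe #-}
-- Let A(x) = Σ a(w) xʷ/w! be the exponential generating function of a. A restricted section
-- contributes eˣ and a free one A(x), so p^r_j has generating function e^{rx} A(x)^j. Splitting
-- off the first block of a nonempty preferential arrangement gives A = 1 + (eˣ - 1) A, that is
-- eˣ A + 1 = 2 A, and multiplying by e^{rx} A^{j-1} yields p^{r+1}_j + p^r_{j-1} = 2 p^r_j.
-- On coefficients, products of exponential generating functions are binomial convolutions,
-- so the identity is proved in ℕ in the subtraction-free form p^{r+1}_j + p^r_{j-1} = p^r_j + p^r_j.
module Submission where

open import Defs
open import Relation.Binary.PropositionalEquality using (_≡_; refl; sym; trans; cong; cong₂; module ≡-Reasoning)
open ≡-Reasoning

-- A separate module, so that ℕ's _*_ does not clash with ℤ's in the statement of theorem7.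
module Arrangements where
  open import Data.Nat
    using (ℕ; zero; suc; _+_; _*_; _∸_; _≤_; _<_; _≤′_; ≤′-refl; ≤′-step; z≤n; s≤s; s≤s⁻¹)
  open import Data.Nat.Properties
    using (+-comm; +-assoc; +-identityʳ; *-identityˡ; *-identityʳ; *-zeroʳ; *-assoc; *-distribʳ-+; *-distribˡ-+;
           m∸n≤m; m+[n∸m]≡n; +-∸-assoc; ∸-monoʳ-<; <-≤-trans; ≤⇒≤′; ≤′⇒≤; n<1+n; n≤1+n)
  open import Data.Nat.Combinatorics using (_C_; nCk+nC[k+1]≡[n+1]C[k+1]; k>n⇒nCk≡0)
  open import Data.Nat.Tactic.RingSolver using (solve-∀)
  open import Data.Nat.ListAction using (sum; product)
  open import Data.Nat.ListAction.Properties using (sum-++)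
  open import Data.List using (List; []; _∷_; _++_; map; drop; concatMap; applyUpTo; upTo)
  open import Data.List.Properties using (map-++; map-∘; map-cong; map-cong-local; map-upTo)
  open import Data.List.Relation.Unary.All as All using (All; []; _∷_)
  open import Data.List.Relation.Unary.All.Properties using (concat⁺; map⁺; applyUpTo⁺₁)
  open import Function using (const)

  ∑≤ : ℕ → (ℕ → ℕ) → ℕ
  ∑≤ zero    f = f 0
  ∑≤ (suc n) f = f 0 + ∑≤ n (λ i → f (suc i))

  syntax ∑≤ n (λ i → e) = ∑[ i ≤ n ] e

  ∑-cong : ∀ n {f g : ℕ → ℕ} → (∀ i → i ≤ n → f i ≡ g i) → ∑≤ n f ≡ ∑≤ n g
  ∑-cong zero    f≡g = f≡g 0 z≤n
  ∑-cong (suc n) f≡g = cong₂ _+_ (f≡g 0 z≤n) (∑-cong n (λ i i≤n → f≡g (suc i) (s≤s i≤n)))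

  ∑-zero : ∀ n {f : ℕ → ℕ} → (∀ i → i ≤ n → f i ≡ 0) → ∑≤ n f ≡ 0
  ∑-zero zero    f≡0 = f≡0 0 z≤n
  ∑-zero (suc n) f≡0 = cong₂ _+_ (f≡0 0 z≤n) (∑-zero n (λ i i≤n → f≡0 (suc i) (s≤s i≤n)))

  ∑-distrib-+ : ∀ n (f g : ℕ → ℕ) → ∑[ i ≤ n ] (f i + g i) ≡ ∑≤ n f + ∑≤ n g
  ∑-distrib-+ zero    f g = refl
  ∑-distrib-+ (suc n) f g = begin
    (f 0 + g 0) + ∑[ i ≤ n ] (f (suc i) + g (suc i))
      ≡⟨ cong ((f 0 + g 0) +_) (∑-distrib-+ n _ _) ⟩
    (f 0 + g 0) + (∑[ i ≤ n ] f (suc i) + ∑[ i ≤ n ] g (suc i))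
      ≡⟨ interchange (f 0) (g 0) _ _ ⟩
    (f 0 + ∑[ i ≤ n ] f (suc i)) + (g 0 + ∑[ i ≤ n ] g (suc i)) ∎
    where
    interchange : ∀ w x y z → (w + x) + (y + z) ≡ (w + y) + (x + z)
    interchange = solve-∀

  ∑-snoc : ∀ n (f : ℕ → ℕ) → ∑≤ (suc n) f ≡ ∑≤ n f + f (suc n)
  ∑-snoc zero    f = refl
  ∑-snoc (suc n) f = trans (cong (f 0 +_) (∑-snoc n _)) (sym (+-assoc (f 0) _ _))

  ∑-pad : ∀ {m N} {f : ℕ → ℕ} → (∀ i → m < i → f i ≡ 0) → m ≤ N → ∑≤ N f ≡ ∑≤ m f
  ∑-pad {m} {f = f} f≡0 m≤N = go (≤⇒≤′ m≤N)
    where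
    go : ∀ {N} → m ≤′ N → ∑≤ N f ≡ ∑≤ m f
    go ≤′-refl = refl
    go (≤′-step {N} m≤′N) = begin
      ∑≤ (suc N) f       ≡⟨ ∑-snoc N f ⟩
      ∑≤ N f + f (suc N) ≡⟨ cong (∑≤ N f +_) (f≡0 (suc N) (s≤s (≤′⇒≤ m≤′N))) ⟩
      ∑≤ N f + 0         ≡⟨ +-identityʳ _ ⟩
      ∑≤ N f             ≡⟨ go m≤′N ⟩
      ∑≤ m f             ∎

  infixl 7 _⋆_

  _⋆_ : (ℕ → ℕ) → (ℕ → ℕ) → ℕ → ℕ
  (f ⋆ g) n = ∑[ k ≤ n ] ((n C k) * (f k * g (n ∸ k)))

  δ : ℕ → ℕ
  δ zero    = 1
  δ (suc _) = 0

  ∂ : (ℕ → ℕ) → ℕ → ℕ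
  ∂ f k = f (suc k)

  ⋆-cong : ∀ n {f f′ g g′ : ℕ → ℕ} →
           (∀ k → k ≤ n → f k ≡ f′ k) → (∀ k → k ≤ n → g k ≡ g′ k) → (f ⋆ g) n ≡ (f′ ⋆ g′) n
  ⋆-cong n f≡f′ g≡g′ = ∑-cong n λ k k≤n →
    cong₂ (λ x y → (n C k) * (x * y)) (f≡f′ k k≤n) (g≡g′ (n ∸ k) (m∸n≤m n k))

  ⋆-distribʳ-+ : ∀ n (f g h : ℕ → ℕ) → ((λ k → f k + g k) ⋆ h) n ≡ (f ⋆ h) n + (g ⋆ h) n
  ⋆-distribʳ-+ n f g h =
    trans (∑-cong n (λ k _ → distrib (n C k) (f k) (g k) (h (n ∸ k)))) (∑-distrib-+ n _ _)
    where
    distrib : ∀ c x y z → c * ((x + y) * z) ≡ c * (x * z) + c * (y * z)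
    distrib = solve-∀

  ⋆-distribˡ-+ : ∀ n (f g h : ℕ → ℕ) → (f ⋆ (λ k → g k + h k)) n ≡ (f ⋆ g) n + (f ⋆ h) n
  ⋆-distribˡ-+ n f g h =
    trans (∑-cong n (λ k _ → distrib (n C k) (f k) (g (n ∸ k)) (h (n ∸ k)))) (∑-distrib-+ n _ _)
    where
    distrib : ∀ c x y z → c * (x * (y + z)) ≡ c * (x * y) + c * (x * z)
    distrib = solve-∀

  ⋆-distribˡ-∑ : ∀ n N (f : ℕ → ℕ) (g : ℕ → ℕ → ℕ) →
                 (f ⋆ (λ k → ∑[ m ≤ N ] g m k)) n ≡ ∑[ m ≤ N ] (f ⋆ g m) n
  ⋆-distribˡ-∑ n zero    f g = refl
  ⋆-distribˡ-∑ n (suc N) f g =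
    trans (⋆-distribˡ-+ n f (g 0) (λ k → ∑[ m ≤ N ] g (suc m) k))
          (cong ((f ⋆ g 0) n +_) (⋆-distribˡ-∑ n N f (λ m → g (suc m))))

  ⋆-identityˡ : ∀ n (g : ℕ → ℕ) → (δ ⋆ g) n ≡ g n
  ⋆-identityˡ zero    g = trans (*-identityˡ _) (*-identityˡ _)
  ⋆-identityˡ (suc n) g = begin
    1 * (1 * g (suc n)) + ∑[ i ≤ n ] ((suc n C suc i) * 0)
      ≡⟨ cong₂ _+_ (trans (*-identityˡ _) (*-identityˡ _)) (∑-zero n (λ i _ → *-zeroʳ (suc n C suc i))) ⟩
    g (suc n) + 0
      ≡⟨ +-identityʳ _ ⟩
    g (suc n) ∎

  -- Pascal's rule splits each coefficient of (f ⋆ g) (1 + n) into a term of f ⋆ ∂ g and one of ∂ f ⋆ g.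
  ⋆-leibniz : ∀ n (f g : ℕ → ℕ) → (f ⋆ g) (suc n) ≡ (∂ f ⋆ g) n + (f ⋆ ∂ g) n
  ⋆-leibniz n f g = begin
    (f ⋆ g) (suc n)                         ≡⟨ ∑-cong (suc n) (λ k _ → pascal k) ⟩
    ∑[ k ≤ suc n ] (left k + right k)        ≡⟨ ∑-distrib-+ (suc n) left right ⟩
    ∑≤ (suc n) left + ∑≤ (suc n) right      ≡⟨ cong (_+ ∑≤ (suc n) right) left-sum ⟩
    (f ⋆ ∂ g) n + (∂ f ⋆ g) n               ≡⟨ +-comm ((f ⋆ ∂ g) n) _ ⟩
    (∂ f ⋆ g) n + (f ⋆ ∂ g) n               ∎
    where
    left : ℕ → ℕ
    left k = (n C k) * (f k * g (suc n ∸ k))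
    right : ℕ → ℕ
    right zero    = 0
    right (suc k) = (n C k) * (f (suc k) * g (n ∸ k))
    pascal : ∀ k → (suc n C k) * (f k * g (suc n ∸ k)) ≡ left k + right k
    pascal zero    = sym (+-identityʳ _)
    pascal (suc k) = begin
      (suc n C suc k) * x           ≡⟨ cong (_* x) (sym (nCk+nC[k+1]≡[n+1]C[k+1] n k)) ⟩
      (n C k + n C suc k) * x     ≡⟨ *-distribʳ-+ x (n C k) _ ⟩
      (n C k) * x + (n C suc k) * x   ≡⟨ +-comm ((n C k) * x) _ ⟩
      (n C suc k) * x + (n C k) * x   ∎
      where
      x = f (suc k) * g (n ∸ k)
    left-sum : ∑≤ (suc n) left ≡ (f ⋆ ∂ g) n
    left-sum = begin
      ∑≤ (suc n) left          ≡⟨ ∑-snoc n left ⟩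
      ∑≤ n left + left (suc n)
        ≡⟨ cong (λ c → ∑≤ n left + c * (f (suc n) * g (n ∸ n))) (k>n⇒nCk≡0 {n} (n<1+n n)) ⟩
      ∑≤ n left + 0
        ≡⟨ +-identityʳ _ ⟩
      ∑≤ n left
        ≡⟨ ∑-cong n (λ k k≤n → cong (λ i → (n C k) * (f k * g i)) (+-∸-assoc 1 k≤n)) ⟩
      (f ⋆ ∂ g) n ∎

  ⋆-assoc : ∀ n (f g h : ℕ → ℕ) → (f ⋆ (g ⋆ h)) n ≡ ((f ⋆ g) ⋆ h) n
  ⋆-assoc zero    f g h = reassoc (f 0) (g 0) (h 0)
    where
    reassoc : ∀ x y z → 1 * (x * (1 * (y * z))) ≡ 1 * ((1 * (x * y)) * z)
    reassoc = solve-∀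
  ⋆-assoc (suc m) f g h = begin
    (f ⋆ (g ⋆ h)) (suc m)
      ≡⟨ ⋆-leibniz m f (g ⋆ h) ⟩
    (∂ f ⋆ (g ⋆ h)) m + (f ⋆ ∂ (g ⋆ h)) m
      ≡⟨ cong ((∂ f ⋆ (g ⋆ h)) m +_) (trans (⋆-cong m {f = f} (λ _ _ → refl) (λ k _ → ⋆-leibniz k g h))
                                            (⋆-distribˡ-+ m f (∂ g ⋆ h) (g ⋆ ∂ h))) ⟩
    (∂ f ⋆ (g ⋆ h)) m + ((f ⋆ (∂ g ⋆ h)) m + (f ⋆ (g ⋆ ∂ h)) m)
      ≡⟨ cong₂ _+_ (⋆-assoc m (∂ f) g h) (cong₂ _+_ (⋆-assoc m f (∂ g) h) (⋆-assoc m f g (∂ h))) ⟩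
    ((∂ f ⋆ g) ⋆ h) m + (((f ⋆ ∂ g) ⋆ h) m + ((f ⋆ g) ⋆ ∂ h) m)
      ≡⟨ sym (+-assoc (((∂ f ⋆ g) ⋆ h) m) _ _) ⟩
    (((∂ f ⋆ g) ⋆ h) m + ((f ⋆ ∂ g) ⋆ h) m) + ((f ⋆ g) ⋆ ∂ h) m
      ≡⟨ cong (_+ ((f ⋆ g) ⋆ ∂ h) m)
              (sym (trans (⋆-cong m {g = h} (λ k _ → ⋆-leibniz k f g) (λ _ _ → refl))
                          (⋆-distribʳ-+ m (∂ f ⋆ g) (f ⋆ ∂ g) h))) ⟩
    (∂ (f ⋆ g) ⋆ h) m + ((f ⋆ g) ⋆ ∂ h) m
      ≡⟨ sym (⋆-leibniz m (f ⋆ g) h) ⟩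
    ((f ⋆ g) ⋆ h) (suc m) ∎

  sum-applyUpTo : ∀ (f : ℕ → ℕ) n → sum (applyUpTo f (suc n)) ≡ ∑≤ n f
  sum-applyUpTo f zero    = +-identityʳ (f 0)
  sum-applyUpTo f (suc n) = cong (f 0 +_) (sum-applyUpTo (λ i → f (suc i)) n)

  sum-map-upTo : ∀ (f : ℕ → ℕ) n → sum (map f (upTo (suc n))) ≡ ∑≤ n f
  sum-map-upTo f n = trans (cong sum (map-upTo f (suc n))) (sum-applyUpTo f n)

  sum-map-concatMap : ∀ {A B : Set} (f : B → ℕ) (g : A → List B) xs →
                      sum (map f (concatMap g xs)) ≡ sum (map (λ x → sum (map f (g x))) xs)
  sum-map-concatMap f g []       = refl
  sum-map-concatMap f g (x ∷ xs) = begin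
    sum (map f (g x ++ concatMap g xs))             ≡⟨ cong sum (map-++ f (g x) _) ⟩
    sum (map f (g x) ++ map f (concatMap g xs))     ≡⟨ sum-++ (map f (g x)) _ ⟩
    sum (map f (g x)) + sum (map f (concatMap g xs)) ≡⟨ cong (sum (map f (g x)) +_) (sum-map-concatMap f g xs) ⟩
    sum (map f (g x)) + sum (map (λ x → sum (map f (g x))) xs) ∎

  sum-map-*ˡ : ∀ {A : Set} c (f : A → ℕ) xs → sum (map (λ x → c * f x) xs) ≡ c * sum (map f xs)
  sum-map-*ˡ c f []       = sym (*-zeroʳ c)
  sum-map-*ˡ c f (x ∷ xs) = trans (cong (c * f x +_) (sum-map-*ˡ c f xs)) (sym (*-distribˡ-+ c (f x) _))

  sum-weakCompositions : ∀ m n → All (λ ws → sum ws ≡ n) (weakCompositions m n)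
  sum-weakCompositions zero    zero    = refl ∷ []
  sum-weakCompositions zero    (suc n) = []
  sum-weakCompositions (suc m) n       = concat⁺ (map⁺ (applyUpTo⁺₁ _ (suc n) λ {w} w<1+n →
    map⁺ (All.map (λ s≡n∸w → trans (cong (w +_) s≡n∸w) (m+[n∸m]≡n (s≤s⁻¹ w<1+n)))
                  (sum-weakCompositions m (n ∸ w)))))

  multinomialSum : (List ℕ → ℕ) → ℕ → ℕ → ℕ
  multinomialSum h m n = sum (map (λ ws → multinomial ws * h ws) (weakCompositions m n))

  multinomialSum-cons : ∀ (f : ℕ → ℕ) (g h : List ℕ → ℕ) → (∀ v ws → h (v ∷ ws) ≡ f v * g ws) →
                        ∀ m n → multinomialSum h (suc m) n ≡ (f ⋆ multinomialSum g m) n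
  multinomialSum-cons f g h h≡f*g m n = begin
    multinomialSum h (suc m) n
      ≡⟨ sum-map-concatMap term block (upTo (suc n)) ⟩
    sum (map (λ w → sum (map term (block w))) (upTo (suc n)))
      ≡⟨ sum-map-upTo _ n ⟩
    ∑[ w ≤ n ] sum (map term (block w))
      ≡⟨ ∑-cong n block-sum ⟩
    (f ⋆ multinomialSum g m) n ∎
    where
    term : List ℕ → ℕ
    term ws = multinomial ws * h ws
    block : ℕ → List (List ℕ)
    block w = map (w ∷_) (weakCompositions m (n ∸ w))
    block-sum : ∀ w → w ≤ n → sum (map term (block w)) ≡ (n C w) * (f w * multinomialSum g m (n ∸ w))
    block-sum w w≤n = begin
      sum (map term (map (w ∷_) wss))
        ≡⟨ cong sum (sym (map-∘ wss)) ⟩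
      sum (map (λ ws → term (w ∷ ws)) wss)
        ≡⟨ cong sum (map-cong-local (All.map term-cons (sum-weakCompositions m (n ∸ w)))) ⟩
      sum (map (λ ws → ((n C w) * f w) * (multinomial ws * g ws)) wss)
        ≡⟨ sum-map-*ˡ ((n C w) * f w) _ wss ⟩
      ((n C w) * f w) * multinomialSum g m (n ∸ w)
        ≡⟨ *-assoc (n C w) _ _ ⟩
      (n C w) * (f w * multinomialSum g m (n ∸ w)) ∎
      where
      wss = weakCompositions m (n ∸ w)
      interchange : ∀ x y z t → (x * y) * (z * t) ≡ (x * z) * (y * t)
      interchange = solve-∀
      term-cons : ∀ {ws} → sum ws ≡ n ∸ w → term (w ∷ ws) ≡ ((n C w) * f w) * (multinomial ws * g ws)
      term-cons {ws} s≡n∸w = begin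
        (((w + sum ws) C w) * multinomial ws) * h (w ∷ ws)
          ≡⟨ cong₂ (λ t y → ((t C w) * multinomial ws) * y)
                   (trans (cong (w +_) s≡n∸w) (m+[n∸m]≡n w≤n)) (h≡f*g w ws) ⟩
        ((n C w) * multinomial ws) * (f w * g ws)
          ≡⟨ interchange (n C w) _ _ _ ⟩
        ((n C w) * f w) * (multinomial ws * g ws) ∎

  -- The helpers in the where-blocks of p and compositions are out of scope here. Each
  -- metavariable below is solved by unification to one of them (the with-abstractions make
  -- the unification problem a pattern), and the equation stated with it then holds by refl.
  mutual
    pWeight : ℕ → ℕ → ℕ → List ℕ → ℕ
    pWeight = _

    p-unfold : ∀ r j n →
               p r j n ≡ sum (map (λ ws → multinomial ws * pWeight j n r ws) (weakCompositions (r + j) n))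
    p-unfold r j n = refl

  mutual
    filterPos : ℕ → ℕ → List (List ℕ)
    filterPos = _

    compositions-unfold : ∀ w → compositions w ≡ concatMap (filterPos w) (upTo (suc w))
    compositions-unfold w = refl

  mutual
    keep : ℕ → List (List ℕ) → List (List ℕ)
    keep = _

    filterPos-unfold : ∀ w m → filterPos w m ≡ keep w (weakCompositions m w)
    filterPos-unfold w m with weakCompositions m w
    ... | wss = refl

  mutual
    keepIfPositive : ℕ → List ℕ → List ℕ → List (List ℕ) → List (List ℕ)
    keepIfPositive = _

    keep-suc : ∀ w x xs wss → keep w ((suc x ∷ xs) ∷ wss) ≡ keepIfPositive w (suc x ∷ xs) xs wss
    keep-suc w x xs wss with suc x ∷ xs
    ... | ws = refl

  -- The recursive call changes the argument r that drop' inherits from p; Agda's conversion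
  -- check ignores that argument because drop' never uses it.
  pWeight≡product-drop : ∀ j n r ws → pWeight j n r ws ≡ product (map a (drop r ws))
  pWeight≡product-drop j n zero    ws       = refl
  pWeight≡product-drop j n (suc r) []       = refl
  pWeight≡product-drop j n (suc r) (w ∷ ws) = pWeight≡product-drop j n r ws

  p≡multinomialSum : ∀ r j n → p r j n ≡ multinomialSum (λ ws → product (map a (drop r ws))) (r + j) n
  p≡multinomialSum r j n =
    trans (p-unfold r j n) (cong sum (map-cong (λ ws → cong (multinomial ws *_) (pWeight≡product-drop j n r ws))
                                                (weakCompositions (r + j) n)))

  p-restricted-suc : ∀ r j n → p (suc r) j n ≡ (const 1 ⋆ p r j) n
  p-restricted-suc r j n = begin
    p (suc r) j n
      ≡⟨ p≡multinomialSum (suc r) j n ⟩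
    multinomialSum (λ ws → product (map a (drop (suc r) ws))) (suc (r + j)) n
      ≡⟨ multinomialSum-cons (const 1) _ _ (λ _ _ → sym (*-identityˡ _)) (r + j) n ⟩
    (const 1 ⋆ multinomialSum (λ ws → product (map a (drop r ws))) (r + j)) n
      ≡⟨ ⋆-cong n {f = const 1} (λ _ _ → refl) (λ k _ → sym (p≡multinomialSum r j k)) ⟩
    (const 1 ⋆ p r j) n ∎

  p-free-suc : ∀ j n → p 0 (suc j) n ≡ (a ⋆ p 0 j) n
  p-free-suc j n = begin
    p 0 (suc j) n
      ≡⟨ p≡multinomialSum 0 (suc j) n ⟩
    multinomialSum (λ ws → product (map a ws)) (suc j) n
      ≡⟨ multinomialSum-cons a _ _ (λ _ _ → refl) j n ⟩
    (a ⋆ multinomialSum (λ ws → product (map a ws)) j) n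
      ≡⟨ ⋆-cong n {f = a} (λ _ _ → refl) (λ k _ → sym (p≡multinomialSum 0 j k)) ⟩
    (a ⋆ p 0 j) n ∎

  positive : ℕ → ℕ
  positive zero    = 0
  positive (suc _) = 1

  allPositive : List ℕ → ℕ
  allPositive ws = product (map positive ws)

  orderedPartitions : ℕ → ℕ → ℕ
  orderedPartitions = multinomialSum allPositive

  multinomials : List (List ℕ) → ℕ
  multinomials wss = sum (map multinomial wss)

  multinomials-keepIfPositive : ∀ w ws xs wss →
    multinomials (keepIfPositive w ws xs wss) ≡ multinomial ws * allPositive xs + multinomials (keep w wss)
  multinomials-keepIfPositive w ws []           wss =
    cong (_+ multinomials (keep w wss)) (sym (*-identityʳ _))
  multinomials-keepIfPositive w ws (zero ∷ xs)  wss =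
    cong (_+ multinomials (keep w wss)) (sym (*-zeroʳ (multinomial ws)))
  multinomials-keepIfPositive w ws (suc x ∷ xs) wss = trans (multinomials-keepIfPositive w ws xs wss)
    (cong (λ t → multinomial ws * t + multinomials (keep w wss)) (sym (*-identityˡ (allPositive xs))))

  multinomials-keep-cons : ∀ w ws wss →
    multinomials (keep w (ws ∷ wss)) ≡ multinomial ws * allPositive ws + multinomials (keep w wss)
  multinomials-keep-cons w []           wss = refl
  multinomials-keep-cons w (zero ∷ xs)  wss =
    cong (_+ multinomials (keep w wss)) (sym (*-zeroʳ (multinomial (zero ∷ xs))))
  multinomials-keep-cons w (suc x ∷ xs) wss = begin
    multinomials (keep w ((suc x ∷ xs) ∷ wss))
      ≡⟨ cong multinomials (keep-suc w x xs wss) ⟩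
    multinomials (keepIfPositive w (suc x ∷ xs) xs wss)
      ≡⟨ multinomials-keepIfPositive w (suc x ∷ xs) xs wss ⟩
    multinomial (suc x ∷ xs) * allPositive xs + multinomials (keep w wss)
      ≡⟨ cong (λ t → multinomial (suc x ∷ xs) * t + multinomials (keep w wss))
              (sym (*-identityˡ (allPositive xs))) ⟩
    multinomial (suc x ∷ xs) * allPositive (suc x ∷ xs) + multinomials (keep w wss) ∎

  multinomials-keep : ∀ w wss → multinomials (keep w wss) ≡ sum (map (λ ws → multinomial ws * allPositive ws) wss)
  multinomials-keep w []         = refl
  multinomials-keep w (ws ∷ wss) =
    trans (multinomials-keep-cons w ws wss) (cong (multinomial ws * allPositive ws +_) (multinomials-keep w wss))

  a≡∑orderedPartitions : ∀ w → a w ≡ ∑[ m ≤ w ] orderedPartitions m w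
  a≡∑orderedPartitions w = begin
    a w
      ≡⟨ cong multinomials (compositions-unfold w) ⟩
    multinomials (concatMap (filterPos w) (upTo (suc w)))
      ≡⟨ sum-map-concatMap multinomial (filterPos w) (upTo (suc w)) ⟩
    sum (map (λ m → multinomials (filterPos w m)) (upTo (suc w)))
      ≡⟨ sum-map-upTo _ w ⟩
    ∑[ m ≤ w ] multinomials (filterPos w m)
      ≡⟨ ∑-cong w (λ m _ → trans (cong multinomials (filterPos-unfold w m))
                                 (multinomials-keep w (weakCompositions m w))) ⟩
    ∑[ m ≤ w ] orderedPartitions m w ∎

  orderedPartitions-zero : ∀ w → orderedPartitions 0 w ≡ δ w
  orderedPartitions-zero zero    = refl
  orderedPartitions-zero (suc w) = refl

  orderedPartitions-suc : ∀ m w → orderedPartitions (suc m) w ≡ (positive ⋆ orderedPartitions m) w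
  orderedPartitions-suc = multinomialSum-cons positive allPositive allPositive (λ _ _ → refl)

  orderedPartitions-vanish : ∀ {m w} → w < m → orderedPartitions m w ≡ 0
  orderedPartitions-vanish {suc m} {w} (s≤s w≤m) = trans (orderedPartitions-suc m w) (∑-zero w vanish)
    where
    vanish : ∀ k → k ≤ w → (w C k) * (positive k * orderedPartitions m (w ∸ k)) ≡ 0
    vanish zero    _   = *-zeroʳ (w C 0)
    vanish (suc k) k<w = begin
      (w C suc k) * (1 * orderedPartitions m (w ∸ suc k))
        ≡⟨ cong (λ t → (w C suc k) * (1 * t)) (orderedPartitions-vanish w∸[1+k]<m) ⟩
      (w C suc k) * 0
        ≡⟨ *-zeroʳ (w C suc k) ⟩
      0 ∎
      where
      w∸[1+k]<m : w ∸ suc k < m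
      w∸[1+k]<m = <-≤-trans (∸-monoʳ-< (s≤s z≤n) k<w) w≤m

  a≡∑≤orderedPartitions : ∀ {w N} → w ≤ N → a w ≡ ∑[ m ≤ N ] orderedPartitions m w
  a≡∑≤orderedPartitions {w} w≤N =
    trans (a≡∑orderedPartitions w) (sym (∑-pad (λ m w<m → orderedPartitions-vanish w<m) w≤N))

  -- With positive and δ the coefficients of eˣ - 1 and 1, this is A = 1 + (eˣ - 1) A for the
  -- exponential generating function A of a: splitting off the first block of an arrangement.
  positive⋆a+δ≡a : ∀ w → (positive ⋆ a) w + δ w ≡ a w
  positive⋆a+δ≡a w = begin
    (positive ⋆ a) w + δ w
      ≡⟨ cong (_+ δ w) (⋆-cong w {f = positive} (λ _ _ → refl) (λ k k≤w → a≡∑≤orderedPartitions k≤w)) ⟩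
    (positive ⋆ (λ k → ∑[ m ≤ w ] orderedPartitions m k)) w + δ w
      ≡⟨ cong (_+ δ w) (⋆-distribˡ-∑ w w positive orderedPartitions) ⟩
    ∑[ m ≤ w ] (positive ⋆ orderedPartitions m) w + δ w
      ≡⟨ cong₂ _+_ (∑-cong w (λ m _ → sym (orderedPartitions-suc m w))) (sym (orderedPartitions-zero w)) ⟩
    ∑[ m ≤ w ] orderedPartitions (suc m) w + orderedPartitions 0 w
      ≡⟨ +-comm (∑[ m ≤ w ] orderedPartitions (suc m) w) _ ⟩
    ∑[ m ≤ suc w ] orderedPartitions m w
      ≡⟨ sym (a≡∑≤orderedPartitions (n≤1+n w)) ⟩
    a w ∎

  1⋆a+δ≡a+a : ∀ w → (const 1 ⋆ a) w + δ w ≡ a w + a w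
  1⋆a+δ≡a+a w = begin
    (const 1 ⋆ a) w + δ w
      ≡⟨ cong (_+ δ w) (⋆-cong w {g = a} (λ k _ → 1≡positive+δ k) (λ _ _ → refl)) ⟩
    ((λ k → positive k + δ k) ⋆ a) w + δ w
      ≡⟨ cong (_+ δ w) (⋆-distribʳ-+ w positive δ a) ⟩
    ((positive ⋆ a) w + (δ ⋆ a) w) + δ w
      ≡⟨ cong (λ t → ((positive ⋆ a) w + t) + δ w) (⋆-identityˡ w a) ⟩
    ((positive ⋆ a) w + a w) + δ w
      ≡⟨ right-comm ((positive ⋆ a) w) (a w) (δ w) ⟩
    ((positive ⋆ a) w + δ w) + a w
      ≡⟨ cong (_+ a w) (positive⋆a+δ≡a w) ⟩
    a w + a w ∎
    where
    1≡positive+δ : ∀ k → 1 ≡ positive k + δ k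
    1≡positive+δ zero    = refl
    1≡positive+δ (suc k) = refl
    right-comm : ∀ x y z → (x + y) + z ≡ (x + z) + y
    right-comm = solve-∀

  p-recurrence : ∀ r j n → p (suc r) (suc j) n + p r j n ≡ p r (suc j) n + p r (suc j) n
  p-recurrence zero j n = begin
    p 1 (suc j) n + p 0 j n
      ≡⟨ cong₂ _+_ (p-restricted-suc 0 (suc j) n) (sym (⋆-identityˡ n (p 0 j))) ⟩
    (const 1 ⋆ p 0 (suc j)) n + (δ ⋆ p 0 j) n
      ≡⟨ cong (_+ (δ ⋆ p 0 j) n) (⋆-cong n {f = const 1} (λ _ _ → refl) (λ k _ → p-free-suc j k)) ⟩
    (const 1 ⋆ (a ⋆ p 0 j)) n + (δ ⋆ p 0 j) n
      ≡⟨ cong (_+ (δ ⋆ p 0 j) n) (⋆-assoc n (const 1) a (p 0 j)) ⟩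
    (const 1 ⋆ a ⋆ p 0 j) n + (δ ⋆ p 0 j) n
      ≡⟨ sym (⋆-distribʳ-+ n (const 1 ⋆ a) δ (p 0 j)) ⟩
    ((λ k → (const 1 ⋆ a) k + δ k) ⋆ p 0 j) n
      ≡⟨ ⋆-cong n {g = p 0 j} (λ k _ → 1⋆a+δ≡a+a k) (λ _ _ → refl) ⟩
    ((λ k → a k + a k) ⋆ p 0 j) n
      ≡⟨ ⋆-distribʳ-+ n a a (p 0 j) ⟩
    (a ⋆ p 0 j) n + (a ⋆ p 0 j) n
      ≡⟨ sym (cong₂ _+_ (p-free-suc j n) (p-free-suc j n)) ⟩
    p 0 (suc j) n + p 0 (suc j) n ∎
  p-recurrence (suc r) j n = begin
    p (2 + r) (suc j) n + p (suc r) j n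
      ≡⟨ cong₂ _+_ (p-restricted-suc (suc r) (suc j) n) (p-restricted-suc r j n) ⟩
    (const 1 ⋆ p (suc r) (suc j)) n + (const 1 ⋆ p r j) n
      ≡⟨ sym (⋆-distribˡ-+ n (const 1) (p (suc r) (suc j)) (p r j)) ⟩
    (const 1 ⋆ (λ k → p (suc r) (suc j) k + p r j k)) n
      ≡⟨ ⋆-cong n {f = const 1} (λ _ _ → refl) (λ k _ → p-recurrence r j k) ⟩
    (const 1 ⋆ (λ k → p r (suc j) k + p r (suc j) k)) n
      ≡⟨ ⋆-distribˡ-+ n (const 1) (p r (suc j)) (p r (suc j)) ⟩
    (const 1 ⋆ p r (suc j)) n + (const 1 ⋆ p r (suc j)) n
      ≡⟨ sym (cong₂ _+_ (p-restricted-suc r (suc j) n) (p-restricted-suc r (suc j) n)) ⟩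
    p (suc r) (suc j) n + p (suc r) (suc j) n ∎

open Arrangements using (p-recurrence)

open import Data.Nat using (ℕ; suc)
import Data.Nat as ℕ
import Data.Nat.Properties as ℕ
open import Data.Integer using (+_; _-_; _*_; _⊖_)
open import Data.Integer.Properties using (pos-*; m-n≡m⊖n; ⊖-≥)

x+y≡z+z⇒x≡2z-y : ∀ {x y z} → x ℕ.+ y ≡ z ℕ.+ z → + x ≡ + 2 * + z - + y
x+y≡z+z⇒x≡2z-y {x} {y} {z} x+y≡z+z = sym (begin
  + 2 * + z - + y    ≡⟨ cong (_- + y) (sym (pos-* 2 z)) ⟩
  + (2 ℕ.* z) - + y  ≡⟨ m-n≡m⊖n (2 ℕ.* z) y ⟩
  (2 ℕ.* z) ⊖ y      ≡⟨ cong (_⊖ y) 2z≡x+y ⟩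
  (x ℕ.+ y) ⊖ y      ≡⟨ ⊖-≥ (ℕ.m≤n+m y x) ⟩
  + (x ℕ.+ y ℕ.∸ y)  ≡⟨ cong +_ (ℕ.m+n∸n≡m x y) ⟩
  + x                ∎)
  where
  2z≡x+y : 2 ℕ.* z ≡ x ℕ.+ y
  2z≡x+y = trans (cong (ℕ._+_ z) (ℕ.+-identityʳ z)) (sym x+y≡z+z)

theorem7 : (n r j : ℕ) → + p (suc r) (suc j) n ≡ + 2 * + p r (suc j) n - + p r j n
theorem7 n r j = x+y≡z+z⇒x≡2z-y {z = p r (suc j) n} (p-recurrence r j n)
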